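{- Let $D=(D;V,\exp)$ be a partial E-domain, let $A$ be a $\mathbb{Q}$-vector space complement of $V$ in $D$, and let $I$ be an E-ideal of $D$ containing $A$. Then $I'_A=\sigma_A^{ -1}(I)$ is an E-ideal of $D[t^A]$, and it is the E-ideal of $D[t^A]$ generated by $I$; in fact, as a $D$-module, $I'_A$ is generated by $I$ and $\{t^a-1: a\in A\}$. Moreover, if $I$ is E-maximal, then $I'_A$ is also E-maximal.
   Context: A partial E-domain $(D;V,\exp)$: $D$ an integral domain which is a $\mathbb{Q}$-algebra, $V\supseteq\mathbb{Q}$ a $\mathbb{Q}$-subspace, $\exp:(V,+)\to(D^*,\cdot)$ a group homomorphism. $D[t^A]$ is the group ring of the additive group $A$ over $D$, a partial E-domain with exponential defined on $V\oplus A=D$ by $\exp'(v+a)=\exp(v)t^a$. The augmentation map $\sigma_A:D[t^A]\to D$ is $\sigma_A(\sum_i d_it^{a_i})=\sum_i d_i$. An E-ideal of a partial E-ring $(R;W,\exp)$ is an ideal $I$ with $\exp(w)-1\in I$ for all $w\in I\cap W$; the E-ideal generated by a set is the smallest E-ideal containing it; E-maximal means maximal among proper E-ideals. -}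

module Defs where

open import Level using (Level)
open import Algebra.Bundles using (CommutativeRing)
open import Data.Rational as ℚ using (ℚ)
open import Data.Product using (Σ; ∃; ∃₂; _×_; _,_; proj₁; proj₂)
open import Data.Sum using (_⊎_)
open import Data.List using (List; []; _∷_; _++_; map; concatMap; foldr)
open import Relation.Nullary using (¬_)
open import Relation.Unary using (Pred; _⊆_)

module _ {ℓ : Level} (R : CommutativeRing ℓ ℓ) where
  open CommutativeRing R

  record IsQSubspace (ι : ℚ → Carrier) (W : Pred Carrier ℓ) : Set ℓ where
    field
      W-resp : ∀ {x y} → x ≈ y → W x → W y
      W-0    : W 0#
      W-+    : ∀ {x y} → W x → W y → W (x + y)
      W-scal : ∀ q {x} → W x → W (ι q * x)

  record PartialEDomain : Set (Level.suc ℓ) where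
    field
      1≉0      : ¬ (1# ≈ 0#)
      no-zdiv  : ∀ {x y} → x * y ≈ 0# → (x ≈ 0#) ⊎ (y ≈ 0#)
      ι        : ℚ → Carrier
      ι-1      : ι ℚ.1ℚ ≈ 1#
      ι-+      : ∀ p q → ι (p ℚ.+ q) ≈ ι p + ι q
      ι-*      : ∀ p q → ι (p ℚ.* q) ≈ ι p * ι q
      V        : Pred Carrier ℓ
      V-sub    : IsQSubspace ι V
      V-ℚ      : ∀ q → V (ι q)
      exp      : (x : Carrier) → V x → Carrier
      exp-resp : ∀ {x y} (p : V x) (q : V y) → x ≈ y → exp x p ≈ exp y q
      exp-+    : ∀ {x y} (p : V x) (q : V y) (r : V (x + y)) →
                 exp (x + y) r ≈ exp x p * exp y q
      exp-0    : (p : V 0#) → exp 0# p ≈ 1#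
      exp-unit : ∀ {x} (p : V x) → ∃ λ y → exp x p * y ≈ 1#

  module _ (E : PartialEDomain) where
    open PartialEDomain E

    record IsComplement (A : Pred Carrier ℓ) : Set ℓ where
      field
        A-sub : IsQSubspace ι A
        V∩A   : ∀ {x} → V x → A x → x ≈ 0#
        V+A   : ∀ x → ∃₂ λ v a → V v × A a × x ≈ v + a

    record IsIdeal (I : Pred Carrier ℓ) : Set ℓ where
      field
        I-resp : ∀ {x y} → x ≈ y → I x → I y
        I-0    : I 0#
        I-+    : ∀ {x y} → I x → I y → I (x + y)
        I-*    : ∀ r {x} → I x → I (r * x)

    record IsEIdeal (I : Pred Carrier ℓ) : Set ℓ where
      field
        isIdeal : IsIdeal I
        I-exp   : ∀ {x} (p : V x) → I x → I (exp x p - 1#)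

    record IsEMaximal (I : Pred Carrier ℓ) : Set (Level.suc ℓ) where
      field
        isEIdeal : IsEIdeal I
        proper   : ¬ I 1#
        maximal  : ∀ (J : Pred Carrier ℓ) → IsEIdeal J → ¬ J 1# → I ⊆ J → J ⊆ I

    -- The group ring D[t^A], as formal sums Σ dᵢ t^{aᵢ} (lists of pairs)
    -- modulo the congruence generated by the free-module relations.
    module GroupRing (A : Pred Carrier ℓ) (C : IsComplement A) where
      open IsComplement C
      open IsQSubspace A-sub renaming (W-0 to A-0; W-+ to A-+)

      Term : Set ℓ
      Term = Carrier × Σ Carrier A

      GR : Set ℓ
      GR = List Term

      infix 4 _≋_
      data _≋_ : GR → GR → Set ℓ where
        ≋-refl  : ∀ {l} → l ≋ l
        ≋-sym   : ∀ {l m} → l ≋ m → m ≋ l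
        ≋-trans : ∀ {l m n} → l ≋ m → m ≋ n → l ≋ n
        ≋-cons  : ∀ {d d' a a'} {pa : A a} {pa' : A a'} {l m} →
                  d ≈ d' → a ≈ a' → l ≋ m →
                  ((d , a , pa) ∷ l) ≋ ((d' , a' , pa') ∷ m)
        ≋-swap  : ∀ {s t l} → (s ∷ t ∷ l) ≋ (t ∷ s ∷ l)
        ≋-merge : ∀ {d d' a} {pa : A a} {l} →
                  ((d , a , pa) ∷ (d' , a , pa) ∷ l) ≋ ((d + d' , a , pa) ∷ l)
        ≋-zero  : ∀ {a} {pa : A a} {l} → ((0# , a , pa) ∷ l) ≋ l

      zeroG : GR
      zeroG = []

      _⊕_ : GR → GR → GR
      _⊕_ = _++_

      negT : Term → Term
      negT (d , a) = (- d , a)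

      ⊝_ : GR → GR
      ⊝ l = map negT l

      _⊖_ : GR → GR → GR
      l ⊖ m = l ++ (⊝ m)

      mulT : Term → Term → Term
      mulT (d , a , pa) (e , b , pb) = (d * e , a + b , A-+ pa pb)

      _⊛_ : GR → GR → GR
      l ⊛ m = concatMap (λ s → map (mulT s) m) l

      _•_ : Carrier → GR → GR
      d • l = map (λ s → (d * proj₁ s , proj₂ s)) l

      const : Carrier → GR
      const d = (d , 0# , A-0) ∷ []

      oneG : GR
      oneG = const 1#

      t^ : (a : Carrier) → A a → GR
      t^ a pa = (1# , a , pa) ∷ []

      σ : GR → Carrier
      σ = foldr (λ s r → proj₁ s + r) 0#

      -- ideals / E-ideals of D[t^A]; the exponential is exp'(v + a) = exp(v) t^a
      -- on the constants D = V ⊕ A.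
      record IsGRIdeal (J : Pred GR ℓ) : Set ℓ where
        field
          J-resp : ∀ {l m} → l ≋ m → J l → J m
          J-0    : J zeroG
          J-+    : ∀ {l m} → J l → J m → J (l ⊕ m)
          J-*    : ∀ r {l} → J l → J (r ⊛ l)

      record IsGREIdeal (J : Pred GR ℓ) : Set ℓ where
        field
          isGRIdeal : IsGRIdeal J
          J-exp     : ∀ {w v a} (pv : V v) (pa : A a) → w ≈ v + a →
                      J (const w) → J (((exp v pv , a , pa) ∷ []) ⊖ oneG)

      record IsGREMaximal (J : Pred GR ℓ) : Set (Level.suc ℓ) where
        field
          isGREIdeal : IsGREIdeal J
          proper     : ¬ J oneG
          maximal    : ∀ (K : Pred GR ℓ) → IsGREIdeal K → ¬ K oneG → J ⊆ K → K ⊆ J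

      data Span (S : Pred GR ℓ) : Pred GR ℓ where
        sp-0    : Span S zeroG
        sp-gen  : ∀ d {l} → S l → Span S (d • l)
        sp-+    : ∀ {l m} → Span S l → Span S m → Span S (l ⊕ m)
        sp-resp : ∀ {l m} → l ≋ m → Span S l → Span S m

      data Gens (I : Pred Carrier ℓ) : Pred GR ℓ where
        gen-I : ∀ {x} → I x → Gens I (const x)
        gen-t : ∀ {a} (pa : A a) → Gens I (t^ a pa ⊖ oneG)

      I′ : Pred Carrier ℓ → Pred GR ℓ
      I′ I l = I (σ l)

{-# OPTIONS --safe #-}
-- The augmentation σ is a ring map D[t^A] → D that is the identity on
-- constants, and its kernel is spanned over D by the elements t^a − 1.
-- Hence σ⁻¹(I) is the D-span of I and the t^a − 1, and it is an ideal. It is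
-- an E-ideal because σ(exp(v) t^a − 1) = exp(v) − 1 and v = (v + a) − a ∈ I,
-- using A ⊆ I. Every E-ideal J containing I contains t^a − 1 = exp'(a) − 1,
-- so J ⊇ σ⁻¹(I). For maximality, the constants of a proper E-ideal K ⊇ σ⁻¹(I)
-- form a proper E-ideal of D containing I, hence equal to I, while every
-- l ∈ K has σ(l) ∈ K since l − σ(l) ∈ K.
module Submission where

open import Defs
open import Level using (Level)
open import Algebra.Bundles using (CommutativeRing)
open import Data.Product using (_×_; _,_; proj₁)
open import Data.List using ([]; _∷_; map)
open import Data.List.Properties using (++-assoc; ++-identityʳ)
open import Function.Bundles using (_⇔_; mk⇔)
open import Relation.Binary.Bundles using (Setoid)
import Relation.Binary.PropositionalEquality as ≡
open import Relation.Unary using (Pred; _⊆_)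
import Algebra.Properties.Ring as RingProperties
import Relation.Binary.Reasoning.Setoid as SetoidReasoning

module GroupRingProperties {ℓ : Level} (R : CommutativeRing ℓ ℓ)
    (E : PartialEDomain R) (A : Pred (CommutativeRing.Carrier R) ℓ)
    (C : IsComplement R E A) where
  open CommutativeRing R
  open RingProperties ring using (-0#≈0#; -‿+-comm; -‿distribʳ-*; -1*x≈-x; -‿involutive)
  open PartialEDomain E
  open GroupRing R E A C
  open IsQSubspace (IsComplement.A-sub C) renaming (W-0 to A-0; W-+ to A-+)

  ≋-setoid : Setoid ℓ ℓ
  ≋-setoid = record
    { Carrier = GR
    ; _≈_ = _≋_
    ; isEquivalence = record { refl = ≋-refl ; sym = ≋-sym ; trans = ≋-trans }
    }

  module ≋-Reasoning = SetoidReasoning ≋-setoid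

  ≡⇒≋ : ∀ {l m} → l ≡.≡ m → l ≋ m
  ≡⇒≋ ≡.refl = ≋-refl

  ∷-congʳ : ∀ s {l m} → l ≋ m → (s ∷ l) ≋ (s ∷ m)
  ∷-congʳ (d , a , pa) l≋m = ≋-cons refl refl l≋m

  const-cong : ∀ {x y} → x ≈ y → const x ≋ const y
  const-cong x≈y = ≋-cons x≈y refl ≋-refl

  const-0 : const 0# ≋ zeroG
  const-0 = ≋-zero

  const-⊕ : ∀ x y → (const x ⊕ const y) ≋ const (x + y)
  const-⊕ x y = ≋-merge

  ⊕-congˡ : ∀ k {l m} → l ≋ m → (k ⊕ l) ≋ (k ⊕ m)
  ⊕-congˡ []      l≋m = l≋m
  ⊕-congˡ (s ∷ k) l≋m = ∷-congʳ s (⊕-congˡ k l≋m)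

  ⊕-congʳ : ∀ k {l m} → l ≋ m → (l ⊕ k) ≋ (m ⊕ k)
  ⊕-congʳ k ≋-refl             = ≋-refl
  ⊕-congʳ k (≋-sym p)          = ≋-sym (⊕-congʳ k p)
  ⊕-congʳ k (≋-trans p q)      = ≋-trans (⊕-congʳ k p) (⊕-congʳ k q)
  ⊕-congʳ k (≋-cons d≈ a≈ p)   = ≋-cons d≈ a≈ (⊕-congʳ k p)
  ⊕-congʳ k ≋-swap             = ≋-swap
  ⊕-congʳ k ≋-merge            = ≋-merge
  ⊕-congʳ k ≋-zero             = ≋-zero

  ⊕-identityʳ : ∀ l → (l ⊕ zeroG) ≋ l
  ⊕-identityʳ l = ≡⇒≋ (++-identityʳ l)

  ⊕-assoc : ∀ k l m → ((k ⊕ l) ⊕ m) ≋ (k ⊕ (l ⊕ m))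
  ⊕-assoc k l m = ≡⇒≋ (++-assoc k l m)

  ∷-⊕-shift : ∀ s l k → (s ∷ (l ⊕ k)) ≋ (l ⊕ (s ∷ k))
  ∷-⊕-shift s []      k = ≋-refl
  ∷-⊕-shift s (t ∷ l) k = ≋-trans ≋-swap (∷-congʳ t (∷-⊕-shift s l k))

  ⊕-comm : ∀ l m → (l ⊕ m) ≋ (m ⊕ l)
  ⊕-comm []      m = ≋-sym (⊕-identityʳ m)
  ⊕-comm (s ∷ l) m = ≋-trans (∷-congʳ s (⊕-comm l m)) (∷-⊕-shift s m l)

  ⊕-inverseʳ : ∀ l → (l ⊖ l) ≋ zeroG
  ⊕-inverseʳ []                 = ≋-refl
  ⊕-inverseʳ ((d , a , pa) ∷ l) = begin
    (d , a , pa) ∷ (l ⊕ ((- d , a , pa) ∷ ⊝ l)) ≈⟨ ∷-congʳ _ (≋-sym (∷-⊕-shift _ l (⊝ l))) ⟩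
    (d , a , pa) ∷ (- d , a , pa) ∷ (l ⊖ l)     ≈⟨ ≋-merge ⟩
    (d + - d , a , pa) ∷ (l ⊖ l)                 ≈⟨ ≋-cons (-‿inverseʳ d) refl ≋-refl ⟩
    (0# , a , pa) ∷ (l ⊖ l)                      ≈⟨ ≋-zero ⟩
    l ⊖ l                                        ≈⟨ ⊕-inverseʳ l ⟩
    zeroG                                        ∎
    where open ≋-Reasoning

  ⊝-cancelˡ : ∀ l m → ((⊝ l) ⊕ (l ⊕ m)) ≋ m
  ⊝-cancelˡ l m = begin
    (⊝ l) ⊕ (l ⊕ m) ≈⟨ ≋-sym (⊕-assoc (⊝ l) l m) ⟩
    ((⊝ l) ⊕ l) ⊕ m ≈⟨ ⊕-congʳ m (⊕-comm (⊝ l) l) ⟩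
    (l ⊖ l) ⊕ m     ≈⟨ ⊕-congʳ m (⊕-inverseʳ l) ⟩
    m               ∎
    where open ≋-Reasoning

  -1•≋⊝ : ∀ l → (- 1#) • l ≋ ⊝ l
  -1•≋⊝ []                 = ≋-refl
  -1•≋⊝ ((d , a , pa) ∷ l) = ≋-cons (-1*x≈-x d) refl (-1•≋⊝ l)

  const-⊛ : ∀ d l → (const d ⊛ l) ≋ (d • l)
  const-⊛ d l = ≋-trans (⊕-identityʳ _) (mulT-const l)
    where
    mulT-const : ∀ l → map (mulT (d , 0# , A-0)) l ≋ (d • l)
    mulT-const []                 = ≋-refl
    mulT-const ((e , a , pa) ∷ l) = ≋-cons refl (+-identityˡ a) (mulT-const l)

  σ-const : ∀ x → σ (const x) ≈ x
  σ-const = +-identityʳ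

  σ-⊕ : ∀ l m → σ (l ⊕ m) ≈ σ l + σ m
  σ-⊕ []            m = sym (+-identityˡ (σ m))
  σ-⊕ ((d , _) ∷ l) m = trans (+-congˡ (σ-⊕ l m)) (sym (+-assoc d (σ l) (σ m)))

  σ-• : ∀ d l → σ (d • l) ≈ d * σ l
  σ-• d []            = sym (zeroʳ d)
  σ-• d ((e , _) ∷ l) = trans (+-congˡ (σ-• d l)) (sym (distribˡ d e (σ l)))

  σ-⊛ : ∀ k l → σ (k ⊛ l) ≈ σ k * σ l
  σ-⊛ []      l = sym (zeroˡ (σ l))
  σ-⊛ (s ∷ k) l = begin
    σ (map (mulT s) l ⊕ (k ⊛ l))      ≈⟨ σ-⊕ (map (mulT s) l) (k ⊛ l) ⟩
    σ (map (mulT s) l) + σ (k ⊛ l)    ≈⟨ +-cong (σ-map l) (σ-⊛ k l) ⟩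
    proj₁ s * σ l + σ k * σ l         ≈⟨ distribʳ (σ l) (proj₁ s) (σ k) ⟨
    (proj₁ s + σ k) * σ l             ∎
    where
    open SetoidReasoning setoid
    σ-map : ∀ l → σ (map (mulT s) l) ≈ proj₁ s * σ l
    σ-map []            = sym (zeroʳ (proj₁ s))
    σ-map ((e , _) ∷ l) = trans (+-congˡ (σ-map l)) (sym (distribˡ (proj₁ s) e (σ l)))

  σ-cong : ∀ {l m} → l ≋ m → σ l ≈ σ m
  σ-cong ≋-refl                   = refl
  σ-cong (≋-sym p)                = sym (σ-cong p)
  σ-cong (≋-trans p q)            = trans (σ-cong p) (σ-cong q)
  σ-cong (≋-cons d≈ _ p)          = +-cong d≈ (σ-cong p)
  σ-cong (≋-swap {s} {t} {l})     = x+[y+z]≈y+[x+z] (proj₁ s) (proj₁ t) (σ l)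
    where
    x+[y+z]≈y+[x+z] : ∀ x y z → x + (y + z) ≈ y + (x + z)
    x+[y+z]≈y+[x+z] x y z = trans (sym (+-assoc x y z))
      (trans (+-congʳ (+-comm x y)) (+-assoc y x z))
  σ-cong (≋-merge {d} {d'} {l = l}) = sym (+-assoc d d' (σ l))
  σ-cong (≋-zero {l = l})           = +-identityˡ (σ l)

  σ-t^-1 : ∀ {a} (pa : A a) → σ (t^ a pa ⊖ oneG) ≈ 0#
  σ-t^-1 pa = trans (+-congˡ (+-identityʳ (- 1#))) (-‿inverseʳ 1#)

  record IsAdditivelyClosed (P : Pred GR ℓ) : Set ℓ where
    field
      ∈-resp : ∀ {l m} → l ≋ m → P l → P m
      0∈     : P zeroG
      ⊕∈     : ∀ {l m} → P l → P m → P (l ⊕ m)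

  module KernelOfAugmentation {P : Pred GR ℓ} (P-add : IsAdditivelyClosed P)
      (P-t : ∀ d {a} (pa : A a) → P (d • (t^ a pa ⊖ oneG))) where
    open IsAdditivelyClosed P-add

    ⊖σ∈ : ∀ l → P (l ⊖ const (σ l))
    ⊖σ∈ []                 = ∈-resp (≋-sym (≋-trans (const-cong -0#≈0#) const-0)) 0∈
    ⊖σ∈ ((d , a , pa) ∷ l) = ∈-resp regroup (⊕∈ (P-t d pa) (⊖σ∈ l))
      where
      -d-σl≈-[d+σl] : d * - 1# + - σ l ≈ - (d + σ l)
      -d-σl≈-[d+σl] = trans (+-congʳ (trans (sym (-‿distribʳ-* d 1#)) (-‿cong (*-identityʳ d))))
                            (-‿+-comm d (σ l))
      regroup : ((d * 1# , a , pa) ∷ (d * - 1# , 0# , A-0) ∷ (l ⊖ const (σ l)))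
                ≋ ((d , a , pa) ∷ (l ⊖ const (d + σ l)))
      regroup = ≋-cons (*-identityʳ d) refl
        (≋-trans (∷-⊕-shift _ l _) (⊕-congˡ l (≋-trans ≋-merge (const-cong -d-σl≈-[d+σl]))))

    I′⊆ : ∀ {I : Pred Carrier ℓ} → (∀ {x} → I x → P (const x)) → I′ I ⊆ P
    I′⊆ I⊆P {l} Iσl = ∈-resp reassemble (⊕∈ (⊖σ∈ l) (I⊆P Iσl))
      where
      reassemble : ((l ⊖ const (σ l)) ⊕ const (σ l)) ≋ l
      reassemble = begin
        (l ⊖ const (σ l)) ⊕ const (σ l)   ≈⟨ ⊕-assoc l _ _ ⟩
        l ⊕ (const (- σ l) ⊕ const (σ l)) ≈⟨ ⊕-congˡ l (const-⊕ (- σ l) (σ l)) ⟩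
        l ⊕ const (- σ l + σ l)           ≈⟨ ⊕-congˡ l (const-cong (-‿inverseˡ (σ l))) ⟩
        l ⊕ const 0#                      ≈⟨ ⊕-congˡ l const-0 ⟩
        l ⊕ zeroG                         ≈⟨ ⊕-identityʳ l ⟩
        l                                 ∎
        where open ≋-Reasoning

  module GRIdealProperties {K : Pred GR ℓ} (K-ideal : IsGRIdeal K) where
    open IsGRIdeal K-ideal

    isAdditivelyClosed : IsAdditivelyClosed K
    isAdditivelyClosed = record { ∈-resp = J-resp ; 0∈ = J-0 ; ⊕∈ = J-+ }

    •∈ : ∀ d {l} → K l → K (d • l)
    •∈ d {l} Kl = J-resp (const-⊛ d l) (J-* (const d) Kl)

    ⊝∈ : ∀ {l} → K l → K (⊝ l)
    ⊝∈ {l} Kl = J-resp (-1•≋⊝ l) (•∈ (- 1#) Kl)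

  module GREIdealProperties {K : Pred GR ℓ} (K-E : IsGREIdeal K) where
    open IsGREIdeal K-E
    open IsGRIdeal isGRIdeal
    open GRIdealProperties isGRIdeal

    -- t^a − 1 = exp'(a) − 1, as a = 0 + a with exp(0) = 1.
    t^-1∈ : ∀ {a} (pa : A a) → K (const a) → K (t^ a pa ⊖ oneG)
    t^-1∈ {a} pa Ka = J-resp (≋-cons (exp-0 V-0) refl ≋-refl)
                             (J-exp V-0 pa (sym (+-identityˡ a)) Ka)
      where open IsQSubspace V-sub renaming (W-0 to V-0)

    module _ (A⊆K : ∀ {a} → A a → K (const a)) where

      ⊖σ∈ : ∀ l → K (l ⊖ const (σ l))
      ⊖σ∈ = KernelOfAugmentation.⊖σ∈ isAdditivelyClosed (λ d pa → •∈ d (t^-1∈ pa (A⊆K pa)))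

      I′⊆ : ∀ {I : Pred Carrier ℓ} → (∀ {x} → I x → K (const x)) → I′ I ⊆ K
      I′⊆ = KernelOfAugmentation.I′⊆ isAdditivelyClosed (λ d pa → •∈ d (t^-1∈ pa (A⊆K pa)))

      const-σ∈ : ∀ {l} → K l → K (const (σ l))
      const-σ∈ {l} Kl = J-resp (const-cong (-‿involutive (σ l))) (⊝∈ K-σl)
        where
        K-σl : K (const (- σ l))
        K-σl = J-resp (⊝-cancelˡ l _) (J-+ (⊝∈ Kl) (⊖σ∈ l))

    constants : Pred Carrier ℓ
    constants x = K (const x)

    constants-isEIdeal : IsEIdeal R E constants
    constants-isEIdeal = record
      { isIdeal = record
        { I-resp = λ x≈y → J-resp (const-cong x≈y)
        ; I-0    = J-resp (≋-sym const-0) J-0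
        ; I-+    = λ {x} {y} Kx Ky → J-resp (const-⊕ x y) (J-+ Kx Ky)
        ; I-*    = λ r → •∈ r
        }
      ; I-exp = λ {x} pv Kx → J-resp ≋-merge (J-exp pv A-0 (sym (+-identityʳ x)) Kx)
      }

  module AugmentationPreimage {I : Pred Carrier ℓ} (I-E : IsEIdeal R E I) (A⊆I : A ⊆ I) where
    open IsEIdeal I-E
    open IsIdeal isIdeal

    const∈I′ : ∀ {x} → I x → I′ I (const x)
    const∈I′ {x} = I-resp (sym (σ-const x))

    I′-isGREIdeal : IsGREIdeal (I′ I)
    I′-isGREIdeal = record
      { isGRIdeal = record
        { J-resp = λ l≋m → I-resp (σ-cong l≋m)
        ; J-0    = I-0
        ; J-+    = λ {l} {m} Il Im → I-resp (sym (σ-⊕ l m)) (I-+ Il Im)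
        ; J-*    = λ k {l} Il → I-resp (sym (σ-⊛ k l)) (I-* (σ k) Il)
        }
      ; J-exp = I′-exp
      }
      where
      I′-exp : ∀ {w v a} (pv : V v) (pa : A a) → w ≈ v + a →
               I′ I (const w) → I′ I (((exp v pv , a , pa) ∷ []) ⊖ oneG)
      I′-exp {w} {v} {a} pv pa w≈v+a Iw =
        I-resp (+-congˡ (sym (σ-const (- 1#)))) (I-exp pv Iv)
        where
        w-a≈v : w + - 1# * a ≈ v
        w-a≈v = begin
          w + - 1# * a   ≈⟨ +-cong w≈v+a (-1*x≈-x a) ⟩
          (v + a) + - a  ≈⟨ +-assoc v a (- a) ⟩
          v + (a + - a)  ≈⟨ +-congˡ (-‿inverseʳ a) ⟩
          v + 0#         ≈⟨ +-identityʳ v ⟩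
          v              ∎
          where open SetoidReasoning setoid
        Iv : I v
        Iv = I-resp w-a≈v (I-+ (I-resp (σ-const w) Iw) (I-* (- 1#) (A⊆I pa)))

    I′-least : ∀ (J : Pred GR ℓ) → IsGREIdeal J → (∀ {x} → I x → J (const x)) → I′ I ⊆ J
    I′-least J J-E I⊆J = GREIdealProperties.I′⊆ J-E (λ pa → I⊆J (A⊆I pa)) I⊆J

    Span⊆I′ : Span (Gens I) ⊆ I′ I
    Span⊆I′ sp-0                 = I-0
    Span⊆I′ (sp-gen d {l} g)     = I-resp (sym (σ-• d l)) (I-* d (Gens⊆I′ g))
      where
      Gens⊆I′ : Gens I ⊆ I′ I
      Gens⊆I′ (gen-I Ix) = const∈I′ Ix
      Gens⊆I′ (gen-t pa) = I-resp (sym (σ-t^-1 pa)) I-0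
    Span⊆I′ (sp-+ {l} {m} p q)   = I-resp (sym (σ-⊕ l m)) (I-+ (Span⊆I′ p) (Span⊆I′ q))
    Span⊆I′ (sp-resp l≋m p)      = I-resp (σ-cong l≋m) (Span⊆I′ p)

    I′⊆Span : I′ I ⊆ Span (Gens I)
    I′⊆Span = KernelOfAugmentation.I′⊆ span-additive (λ d pa → sp-gen d (gen-t pa))
      (λ {x} Ix → sp-resp (const-cong (*-identityˡ x)) (sp-gen 1# (gen-I Ix)))
      where
      span-additive : IsAdditivelyClosed (Span (Gens I))
      span-additive = record { ∈-resp = sp-resp ; 0∈ = sp-0 ; ⊕∈ = sp-+ }

    I′⇔Span : ∀ l → I′ I l ⇔ Span (Gens I) l
    I′⇔Span l = mk⇔ I′⊆Span Span⊆I′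

    I′-isGREMaximal : IsEMaximal R E I → IsGREMaximal (I′ I)
    I′-isGREMaximal I-max = record
      { isGREIdeal = I′-isGREIdeal
      ; proper     = λ I′1 → IsEMaximal.proper I-max (I-resp (σ-const 1#) I′1)
      ; maximal    = λ K K-E ¬K1 I′⊆K →
          let open GREIdealProperties K-E
              I⊆K : ∀ {x} → I x → K (const x)
              I⊆K Ix = I′⊆K (const∈I′ Ix)
          in  λ Kl → IsEMaximal.maximal I-max constants constants-isEIdeal ¬K1 I⊆K
                       (const-σ∈ (λ pa → I⊆K (A⊆I pa)) Kl)
      }

lemma3p9 : ∀ {ℓ : Level} (R : CommutativeRing ℓ ℓ) (E : PartialEDomain R)
    (A : Pred (CommutativeRing.Carrier R) ℓ) (C : IsComplement R E A)
    (I : Pred (CommutativeRing.Carrier R) ℓ) →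
    IsEIdeal R E I → A ⊆ I →
    let open GroupRing R E A C in
    IsGREIdeal (I′ I)
    × ((∀ {x} → I x → I′ I (const x))
    × (∀ (J : Pred GR ℓ) → IsGREIdeal J → (∀ {x} → I x → J (const x)) → I′ I ⊆ J))
    × (∀ l → I′ I l ⇔ Span (Gens I) l)
    × (IsEMaximal R E I → IsGREMaximal (I′ I))
lemma3p9 R E A C I I-E A⊆I =
  I′-isGREIdeal , (const∈I′ , I′-least) , I′⇔Span , I′-isGREMaximal
  where open GroupRingProperties.AugmentationPreimage R E A C I-E A⊆I
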